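{- Let $q$ be a prime power, $h\ge2$, and let $k=t_1+t_2$ with integers $t_1,t_2\ge 1$. Let $\alpha\in\mathbb{F}_{q^h}\setminus\mathbb{F}_q$ with $[\mathbb{F}_q(\alpha):\mathbb{F}_q]=s$, where $k-1\le s$ and $s\mid h$. In $\Sigma^*=\mathrm{PG}(k-1,q^h)$ with standard basis vectors $\mathbf{e}_1,\dots,\mathbf{e}_k$, write $\mathbf{e}_{1,j}=\mathbf{e}_j$ for $1\le j\le t_1$ and $\mathbf{e}_{2,j}=\mathbf{e}_{t_1+j}$ for $1\le j\le t_2$. For $i=1,2$ let $\pi_i=\emptyset$ if $t_i=1$, and otherwise $\pi_i=\langle\langle\mathbf{e}_{i,1}-\alpha\mathbf{e}_{i,2}\rangle,\langle\mathbf{e}_{i,2}-\alpha\mathbf{e}_{i,3}\rangle,\dots,\langle\mathbf{e}_{i,t_i-1}-\alpha\mathbf{e}_{i,t_i}\rangle\rangle$. Let $\Omega=\langle\langle\mathbf{e}_{1,t_1}\rangle,\langle\mathbf{e}_{2,t_2}\rangle\rangle$ (a line) and $\Pi=\langle\pi_1,\pi_2\rangle$ (a $(k-3)$-dimensional subspace). Let $\Sigma=\mathrm{PG}(k-1,q)$ be the canonical subgeometry of $\Sigma^*$ (points having homogeneous coordinates in $\mathbb{F}_q$). Then the projection of $\Sigma$ from $\Pi$ onto $\Omega$, i.e. the set $\{\langle x,\Pi\rangle\cap\Omega\mid x\in\Sigma\}$, is an $\mathbb{F}_q$-linear set of rank $k$ in $\Omega=\mathrm{PG}(1,q^h)$.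
   Context: An $\mathbb{F}_q$-linear set of rank $k$ in $\mathrm{PG}(V)$, $V=\mathbb{F}_{q^h}^r$, is a set $\{\langle u\rangle_{\mathbb{F}_{q^h}}\mid u\in U\setminus\{0\}\}$ where $U$ is a $k$-dimensional $\mathbb{F}_q$-subspace of $V$. Angle brackets around a vector denote the projective point it determines; outer angle brackets denote the span of the points. -}

module Defs where

open import Level using (Level; 0ℓ)
open import Data.Nat as ℕ using (ℕ; zero; suc; _∸_; _≤_; _<_)
open import Data.Nat.Primality using (Prime)
open import Data.Fin using (Fin; toℕ)
open import Data.Product using (Σ; ∃; _×_; _,_)
open import Data.Sum using (_⊎_)
open import Relation.Nullary using (¬_; yes; no)
open import Relation.Binary.PropositionalEquality using (_≡_; _≢_)
open import Algebra.Structures using (IsCommutativeRing)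
open import Function.Bundles using (_↔_; _⇔_)

record Field : Set₁ where
  field
    Carrier : Set
    _+_ _*_ : Carrier → Carrier → Carrier
    -_      : Carrier → Carrier
    0# 1#   : Carrier
    isCommutativeRing : IsCommutativeRing _≡_ _+_ _*_ -_ 0# 1#
    0≢1     : 0# ≢ 1#
    inverse : ∀ x → x ≢ 0# → Σ Carrier λ y → x * y ≡ 1#
  infixl 7 _*_
  infixl 6 _+_
  infix  8 -_

  _^_ : Carrier → ℕ → Carrier
  x ^ zero  = 1#
  x ^ suc n = x * (x ^ n)

IsPrimePower : ℕ → Set
IsPrimePower q = Σ ℕ λ p → Σ ℕ λ n → Prime p × 1 ≤ n × q ≡ p ℕ.^ n

HasOrder : Field → ℕ → Set
HasOrder F m = Field.Carrier F ↔ Fin m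

module _ (F : Field) (q : ℕ) where
  open Field F

  -- the subfield F_q of F_{q^h}: the elements fixed by x ↦ x^q
  -- (this is the unique subfield of order q of a field of order q^h)
  InFq : Carrier → Set
  InFq x = x ^ q ≡ x

  sumFin : ∀ {n} → (Fin n → Carrier) → Carrier
  sumFin {zero}  f = 0#
  sumFin {suc n} f = f Data.Fin.zero + sumFin (λ i → f (Data.Fin.suc i))

  -- [F_q(α) : F_q] = s : 1, α, …, α^(s-1) are F_q-linearly independent
  -- and α^s is an F_q-linear combination of them
  -- (i.e. the minimal polynomial of α over F_q has degree s)
  DegreeOver : Carrier → ℕ → Set
  DegreeOver α s =
    (∀ (c : Fin s → Carrier) → (∀ i → InFq (c i)) →
       sumFin (λ i → c i * (α ^ toℕ i)) ≡ 0# → ∀ i → c i ≡ 0#)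
    × Σ (Fin s → Carrier) λ c → (∀ i → InFq (c i)) ×
         α ^ s ≡ sumFin (λ i → c i * (α ^ toℕ i))

  -- Vectors of F^k (homogeneous coordinates of PG(k-1, q^h))

  Vect : ℕ → Set
  Vect k = Fin k → Carrier

  module _ {k : ℕ} where
    _≈_ : Vect k → Vect k → Set
    u ≈ v = ∀ i → u i ≡ v i

    zeroV : Vect k
    zeroV _ = 0#

    _⊕_ : Vect k → Vect k → Vect k
    (u ⊕ v) i = u i + v i

    _·_ : Carrier → Vect k → Vect k
    (a · v) i = a * v i

    NonZero : Vect k → Set
    NonZero v = ¬ (v ≈ zeroV)

    SamePoint : Vect k → Vect k → Set
    SamePoint u v = NonZero u × NonZero v ×
      Σ Carrier λ a → a ≢ 0# × u ≈ (a · v)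

    sumRange : ℕ → (ℕ → Vect k) → Vect k
    sumRange zero    f = zeroV
    sumRange (suc n) f = sumRange n f ⊕ f n

    sumFinV : ∀ {n} → (Fin n → Vect k) → Vect k
    sumFinV {zero}  f = zeroV
    sumFinV {suc n} f = f Data.Fin.zero ⊕ sumFinV (λ i → f (Data.Fin.suc i))

    -- standard basis vector e_{j+1} (0-based index j); zero if j ≥ k
    E : ℕ → Vect k
    E j m with toℕ m ℕ.≟ j
    ... | yes _ = 1#
    ... | no  _ = 0#

    InSubgeometry : Vect k → Set
    InSubgeometry x = NonZero x × (∀ i → InFq (x i))

  -- The configuration of the lemma, with k = t₁ + t₂ and 0-based indices:
  --   e_{1,j} = E (j-1)        (1 ≤ j ≤ t₁)
  --   e_{2,j} = E (t₁ + j - 1)  (1 ≤ j ≤ t₂)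

  module Config (α : Carrier) (t₁ t₂ : ℕ) where
    k : ℕ
    k = t₁ ℕ.+ t₂

    gen₁ : ℕ → Vect k
    gen₁ j = E j ⊕ ((- α) · E (suc j))

    gen₂ : ℕ → Vect k
    gen₂ j = E (t₁ ℕ.+ j) ⊕ ((- α) · E (t₁ ℕ.+ suc j))

    -- the vector subspace underlying Π = ⟨π₁, π₂⟩ (F_{q^h}-span of the
    -- generators; π_i = ∅ when t_i = 1, i.e. no generators)
    InΠ : Vect k → Set
    InΠ v = Σ (ℕ → Carrier) λ c₁ → Σ (ℕ → Carrier) λ c₂ →
      v ≈ (sumRange (t₁ ∸ 1) (λ j → c₁ j · gen₁ j)
           ⊕ sumRange (t₂ ∸ 1) (λ j → c₂ j · gen₂ j))

    eΩ₁ eΩ₂ : Vect k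
    eΩ₁ = E (t₁ ∸ 1)
    eΩ₂ = E (t₁ ℕ.+ t₂ ∸ 1)

    InΩ : Vect k → Set
    InΩ v = Σ Carrier λ a → Σ Carrier λ b → v ≈ ((a · eΩ₁) ⊕ (b · eΩ₂))

    InSpanXΠ : Vect k → Vect k → Set
    InSpanXΠ x v = Σ Carrier λ c → Σ (Vect k) λ w → InΠ w × v ≈ ((c · x) ⊕ w)

    InProjection : Vect k → Set
    InProjection P = NonZero P × InΩ P ×
      Σ (Vect k) λ x → InSubgeometry x × InSpanXΠ x P

  -- F_q-linear sets of rank r in PG(k-1,q^h), contained in a given
  -- subspace W: U is an r-dimensional F_q-subspace of the vector
  -- subspace underlying W (given by an F_q-basis u₀ … u_{r-1}), and the
  -- point set is { ⟨u⟩ : u ∈ U ∖ {0} }.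

  InFqSpan : ∀ {k r} → (Fin r → Vect k) → Vect k → Set
  InFqSpan {k} {r} u v = Σ (Fin r → Carrier) λ c → (∀ i → InFq (c i)) ×
    (v ≈ sumFinV (λ i → c i · u i))

  FqIndependent : ∀ {k r} → (Fin r → Vect k) → Set
  FqIndependent {k} {r} u = ∀ (c : Fin r → Carrier) → (∀ i → InFq (c i)) →
    sumFinV (λ i → c i · u i) ≈ zeroV → ∀ i → c i ≡ 0#

  -- the point set S (a predicate on representative vectors, closed under
  -- the projective point relation) is an F_q-linear set of rank r in W
  IsLinearSetOfRankIn : ∀ {k} → ℕ → (Vect k → Set) → (Vect k → Set) → Set
  IsLinearSetOfRankIn {k} r W S =
    Σ (Fin r → Vect k) λ u → (∀ i → W (u i)) × FqIndependent u ×
      (∀ (P : Vect k) → S P ⇔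
         (Σ (Vect k) λ v → InFqSpan u v × SamePoint P v))

module Submission where

-- Number coordinates from 0 and write t₁ = d₁ + 1, t₂ = d₂ + 1, so that the blocks are
-- 0 … d₁ and d₁ + 1 … top = k − 1.  The functionals
--   A x = Σ_{j ≤ d₁} x_j α^(d₁ − j)   and   B x = Σ_{j ≤ d₂} x_(t₁ + j) α^(d₂ − j)
-- vanish on every generator e_j − α e_(j+1) of Π, and on Ω they are the coordinates along
-- e_(1,t₁) and e_(2,t₂).  Hence project x = A x · e_(1,t₁) + B x · e_(2,t₂) is constant modulo Π
-- and fixes Ω; conversely x ≡ project x modulo Π, by downward induction over the basis vectors.
-- So ⟨x, Π⟩ ∩ Ω = ⟨project x⟩, and the projection of Σ is the set of points of the F_q-span of
-- project e_0, …, project e_(k−1).  These are F_q-independent: project c = 0 gives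
-- A c = B c = 0, two polynomials of degree < s with coefficients in F_q vanishing at α, which
-- [F_q(α) : F_q] = s forbids.

open import Defs
  using (Field; IsPrimePower; HasOrder; InFq; DegreeOver; module Config; IsLinearSetOfRankIn;
         InFqSpan; FqIndependent; SamePoint; NonZero)
import Defs
open import Level using (0ℓ)
open import Data.Nat as ℕ using (ℕ; zero; suc; _∸_; _<_; z≤n; s≤s; _<?_)
import Data.Nat.Properties as ℕ
open import Data.Nat.Primality using (prime⇒nonZero)
open import Data.Fin using (Fin; toℕ; fromℕ<)
import Data.Fin.Properties as Fin
open import Data.Product using (Σ; _×_; _,_)
open import Data.Empty using (⊥-elim)
open import Relation.Nullary using (yes; no)
open import Relation.Binary.PropositionalEquality
open import Algebra.Bundles using (CommutativeRing)
open import Function.Bundles using (mk⇔)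

module LinearAlgebra (F : Field) (q : ℕ) where
  open Field F

  ring : CommutativeRing 0ℓ 0ℓ
  ring = record { isCommutativeRing = isCommutativeRing }

  open CommutativeRing ring public
    using (+-assoc; +-comm; +-identityˡ; +-identityʳ; *-assoc; *-identityˡ; *-identityʳ;
           distribˡ; distribʳ; zeroˡ; zeroʳ; -‿inverseʳ)
  open import Algebra.Properties.Semiring.Sum (CommutativeRing.semiring ring) public
  open import Algebra.Properties.CommutativeSemigroup (CommutativeRing.+-commutativeSemigroup ring)
    public using () renaming (interchange to +-interchange; x∙yz≈y∙xz to +-left-comm)
  open import Algebra.Properties.Ring (CommutativeRing.ring ring) using (-1*x≈-x)

  *-distribˡ-combination : ∀ c a b x y → c * (a * x + b * y) ≡ c * a * x + c * b * y
  *-distribˡ-combination c a b x y =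
    trans (distribˡ c (a * x) (b * y)) (sym (cong₂ _+_ (*-assoc c a x) (*-assoc c b y)))

  sumFin≡sum : ∀ {n} (f : Fin n → Carrier) → Defs.sumFin F q f ≡ sum f
  sumFin≡sum {zero}  f = refl
  sumFin≡sum {suc n} f = cong (f Fin.zero +_) (sumFin≡sum (λ i → f (Fin.suc i)))

  sum-zero : ∀ {n} (f : Fin n → Carrier) → (∀ i → f i ≡ 0#) → sum f ≡ 0#
  sum-zero {n} f f≡0 = trans (sum-cong-≗ f≡0) (sum-replicate-zero n)

  sum-select : ∀ {n} (f : Fin n → Carrier) (i₀ : Fin n) →
               (∀ i → i ≢ i₀ → f i ≡ 0#) → sum f ≡ f i₀
  sum-select f Fin.zero f≡0 = begin
    f Fin.zero + sum (λ i → f (Fin.suc i)) ≡⟨ cong (f Fin.zero +_) (sum-zero _ (λ i → f≡0 (Fin.suc i) λ ())) ⟩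
    f Fin.zero + 0#                         ≡⟨ +-identityʳ _ ⟩
    f Fin.zero                              ∎
    where open ≡-Reasoning
  sum-select f (Fin.suc i₀) f≡0 = begin
    f Fin.zero + sum (λ i → f (Fin.suc i)) ≡⟨ cong₂ _+_ (f≡0 Fin.zero λ ()) (sum-select _ i₀ tail≡0) ⟩
    0# + f (Fin.suc i₀)                     ≡⟨ +-identityˡ _ ⟩
    f (Fin.suc i₀)                          ∎
    where
    open ≡-Reasoning
    tail≡0 : ∀ i → i ≢ i₀ → f (Fin.suc i) ≡ 0#
    tail≡0 i i≢i₀ = f≡0 (Fin.suc i) (λ eq → i≢i₀ (Fin.suc-injective eq))

  sumℕ : ℕ → (ℕ → Carrier) → Carrier
  sumℕ n g = sum {n} (λ i → g (toℕ i))

  sumℕ-cong : ∀ n {g h : ℕ → Carrier} → (∀ j → j < n → g j ≡ h j) → sumℕ n g ≡ sumℕ n h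
  sumℕ-cong n g≡h = sum-cong-≗ {n} (λ i → g≡h (toℕ i) (Fin.toℕ<n i))

  sumℕ-snoc : ∀ n (g : ℕ → Carrier) → sumℕ (suc n) g ≡ sumℕ n g + g n
  sumℕ-snoc n g = trans (sum-init-last {n} (λ i → g (toℕ i)))
    (cong₂ _+_ (sum-cong-≗ {n} (λ i → cong g (Fin.toℕ-inject₁ i))) (cong g (Fin.toℕ-fromℕ n)))

  sumℕ-select : ∀ n (g : ℕ → Carrier) {j} → j < n → (∀ i → i ≢ j → g i ≡ 0#) → sumℕ n g ≡ g j
  sumℕ-select n g {j} j<n g≡0 = trans (sum-select {n} _ (fromℕ< j<n) off-j) (cong g toℕ≡j)
    where
    toℕ≡j : toℕ (fromℕ< j<n) ≡ j
    toℕ≡j = Fin.toℕ-fromℕ< j<n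
    off-j : ∀ i → i ≢ fromℕ< j<n → g (toℕ i) ≡ 0#
    off-j i i≢ = g≡0 (toℕ i) (λ eq → i≢ (Fin.toℕ-injective (trans eq (sym toℕ≡j))))

  sumℕ-truncate : ∀ {n m} → n ℕ.≤ m → (g : ℕ → Carrier) → (∀ j → n ℕ.≤ j → g j ≡ 0#) →
                  sumℕ m g ≡ sumℕ n g
  sumℕ-truncate {m = m} z≤n g g≡0 = sum-zero {m} _ (λ i → g≡0 (toℕ i) z≤n)
  sumℕ-truncate (s≤s n≤m) g g≡0 =
    cong (g 0 +_) (sumℕ-truncate n≤m (λ j → g (suc j)) (λ j n≤j → g≡0 (suc j) (s≤s n≤j)))

  Vect : ℕ → Set
  Vect = Defs.Vect F q

  infix  4 _≈_
  infixl 6 _⊕_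
  infixr 7 _·_

  _≈_ : ∀ {k} → Vect k → Vect k → Set
  _≈_ = Defs._≈_ F q

  _⊕_ : ∀ {k} → Vect k → Vect k → Vect k
  _⊕_ = Defs._⊕_ F q

  _·_ : ∀ {k} → Carrier → Vect k → Vect k
  _·_ = Defs._·_ F q

  zeroV : ∀ {k} → Vect k
  zeroV = Defs.zeroV F q

  E : ∀ {k} → ℕ → Vect k
  E = Defs.E F q

  sumFinV : ∀ {k n} → (Fin n → Vect k) → Vect k
  sumFinV = Defs.sumFinV F q

  sumRange : ∀ {k} → ℕ → (ℕ → Vect k) → Vect k
  sumRange = Defs.sumRange F q

  unit : ℕ → ℕ → Carrier
  unit j i with i ℕ.≟ j
  ... | yes _ = 1#
  ... | no  _ = 0#

  unit-on : ∀ j → unit j j ≡ 1#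
  unit-on j with j ℕ.≟ j
  ... | yes _   = refl
  ... | no  j≢j = ⊥-elim (j≢j refl)

  unit-off : ∀ {j i} → i ≢ j → unit j i ≡ 0#
  unit-off {j} {i} i≢j with i ℕ.≟ j
  ... | yes i≡j = ⊥-elim (i≢j i≡j)
  ... | no  _   = refl

  module _ {k : ℕ} where

    sumFinV-coord : ∀ {n} (f : Fin n → Vect k) m → sumFinV f m ≡ sum (λ i → f i m)
    sumFinV-coord {zero}  f m = refl
    sumFinV-coord {suc n} f m = cong (f Fin.zero m +_) (sumFinV-coord (λ i → f (Fin.suc i)) m)

    sumRange-coord : ∀ n (f : ℕ → Vect k) m → sumRange n f m ≡ sumℕ n (λ j → f j m)
    sumRange-coord zero    f m = refl
    sumRange-coord (suc n) f m =
      trans (cong (_+ f n m) (sumRange-coord n f m)) (sym (sumℕ-snoc n (λ j → f j m)))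

    E-on : (i : Fin k) {n : ℕ} → toℕ i ≡ n → E n i ≡ 1#
    E-on i {n} i≡n with toℕ i ℕ.≟ n
    ... | yes _   = refl
    ... | no  i≢n = ⊥-elim (i≢n i≡n)

    E-off : (i : Fin k) {n : ℕ} → toℕ i ≢ n → E n i ≡ 0#
    E-off i {n} i≢n with toℕ i ℕ.≟ n
    ... | yes i≡n = ⊥-elim (i≢n i≡n)
    ... | no  _   = refl

    basis-expansion : (x : Vect k) → x ≈ sumFinV (λ i → x i · E (toℕ i))
    basis-expansion x m = sym (begin
      sumFinV (λ i → x i · E (toℕ i)) m ≡⟨ sumFinV-coord (λ i → x i · E (toℕ i)) m ⟩
      sum (λ i → x i * E (toℕ i) m)    ≡⟨ sum-select _ m off-diagonal ⟩
      x m * E (toℕ m) m                ≡⟨ cong (x m *_) (E-on m refl) ⟩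
      x m * 1#                         ≡⟨ *-identityʳ (x m) ⟩
      x m                              ∎)
      where
      open ≡-Reasoning
      off-diagonal : ∀ i → i ≢ m → x i * E (toℕ i) m ≡ 0#
      off-diagonal i i≢m =
        trans (cong (x i *_) (E-off m (λ eq → i≢m (Fin.toℕ-injective (sym eq))))) (zeroʳ (x i))

    combination : ℕ → (ℕ → Vect k) → (ℕ → Carrier) → Vect k
    combination n g c = sumRange n (λ j → c j · g j)

    combination-+ : ∀ n g c c′ →
      combination n g (λ j → c j + c′ j) ≈ combination n g c ⊕ combination n g c′
    combination-+ n g c c′ m = begin
      combination n g (λ j → c j + c′ j) m
        ≡⟨ sumRange-coord n _ m ⟩
      sumℕ n (λ j → (c j + c′ j) * g j m)
        ≡⟨ sumℕ-cong n (λ j _ → distribʳ (g j m) (c j) (c′ j)) ⟩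
      sumℕ n (λ j → c j * g j m + c′ j * g j m)
        ≡⟨ ∑-distrib-+ {n} _ _ ⟩
      sumℕ n (λ j → c j * g j m) + sumℕ n (λ j → c′ j * g j m)
        ≡⟨ sym (cong₂ _+_ (sumRange-coord n _ m) (sumRange-coord n _ m)) ⟩
      combination n g c m + combination n g c′ m
        ∎
      where open ≡-Reasoning

    combination-* : ∀ n g a c → combination n g (λ j → a * c j) ≈ a · combination n g c
    combination-* n g a c m = begin
      combination n g (λ j → a * c j) m      ≡⟨ sumRange-coord n _ m ⟩
      sumℕ n (λ j → a * c j * g j m)         ≡⟨ sumℕ-cong n (λ j _ → *-assoc a (c j) (g j m)) ⟩
      sumℕ n (λ j → a * (c j * g j m))       ≡⟨ sym (*-distribˡ-sum {n} a _) ⟩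
      a * sumℕ n (λ j → c j * g j m)         ≡⟨ cong (a *_) (sym (sumRange-coord n _ m)) ⟩
      a * combination n g c m                ∎
      where open ≡-Reasoning

    combination-0 : ∀ n g → combination n g (λ _ → 0#) ≈ zeroV
    combination-0 n g m = trans (sumRange-coord n _ m) (sum-zero {n} _ (λ i → zeroˡ (g (toℕ i) m)))

    combination-unit : ∀ n g {j} → j < n → combination n g (unit j) ≈ g j
    combination-unit n g {j} j<n m = begin
      combination n g (unit j) m          ≡⟨ sumRange-coord n _ m ⟩
      sumℕ n (λ i → unit j i * g i m)     ≡⟨ sumℕ-select n _ j<n off-j ⟩
      unit j j * g j m                    ≡⟨ cong (_* g j m) (unit-on j) ⟩
      1# * g j m                          ≡⟨ *-identityˡ (g j m) ⟩
      g j m                               ∎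
      where
      open ≡-Reasoning
      off-j : ∀ i → i ≢ j → unit j i * g i m ≡ 0#
      off-j i i≢j = trans (cong (_* g i m) (unit-off i≢j)) (zeroˡ (g i m))

  record IsSubspace {k} (W : Vect k → Set) : Set where
    field
      zeroV∈   : W zeroV
      ⊕-closed : ∀ {u v} → W u → W v → W (u ⊕ v)
      ·-closed : ∀ a {v} → W v → W (a · v)
      ≈-closed : ∀ {u v} → u ≈ v → W u → W v

  module Congruence {k} {W : Vect k → Set} (W-subspace : IsSubspace W) where
    open IsSubspace W-subspace

    infix 4 _∼_
    _∼_ : Vect k → Vect k → Set
    u ∼ v = Σ (Vect k) λ w → W w × u ≈ v ⊕ w

    ≈⇒∼ : ∀ {u v} → u ≈ v → u ∼ v
    ≈⇒∼ u≈v = zeroV , zeroV∈ , λ m → trans (u≈v m) (sym (+-identityʳ _))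

    ∼-sym : ∀ {u v} → u ∼ v → v ∼ u
    ∼-sym {u} {v} (w , w∈W , u≈v⊕w) = - 1# · w , ·-closed (- 1#) w∈W , λ m → sym (begin
      u m + - 1# * w m       ≡⟨ cong₂ _+_ (u≈v⊕w m) (-1*x≈-x (w m)) ⟩
      v m + w m + - w m      ≡⟨ +-assoc (v m) (w m) (- w m) ⟩
      v m + (w m + - w m)    ≡⟨ cong (v m +_) (-‿inverseʳ (w m)) ⟩
      v m + 0#               ≡⟨ +-identityʳ (v m) ⟩
      v m                    ∎)
      where open ≡-Reasoning

    ∼-trans : ∀ {u v x} → u ∼ v → v ∼ x → u ∼ x
    ∼-trans (w₁ , w₁∈W , u≈) (w₂ , w₂∈W , v≈) = w₂ ⊕ w₁ , ⊕-closed w₂∈W w₁∈W ,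
      λ m → trans (u≈ m) (trans (cong (_+ w₁ m) (v≈ m)) (+-assoc _ (w₂ m) (w₁ m)))

    ∼-≈-trans : ∀ {u v x} → u ∼ v → v ≈ x → u ∼ x
    ∼-≈-trans u∼v v≈x = ∼-trans u∼v (≈⇒∼ v≈x)

    ≈-∼-trans : ∀ {u v x} → u ≈ v → v ∼ x → u ∼ x
    ≈-∼-trans u≈v v∼x = ∼-trans (≈⇒∼ u≈v) v∼x

    ∼-⊕ : ∀ {u u′ v v′} → u ∼ u′ → v ∼ v′ → u ⊕ v ∼ u′ ⊕ v′
    ∼-⊕ (w₁ , w₁∈W , u≈) (w₂ , w₂∈W , v≈) = w₁ ⊕ w₂ , ⊕-closed w₁∈W w₂∈W ,
      λ m → trans (cong₂ _+_ (u≈ m) (v≈ m)) (+-interchange _ (w₁ m) _ (w₂ m))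

    ∼-· : ∀ a {u v} → u ∼ v → a · u ∼ a · v
    ∼-· a (w , w∈W , u≈) = a · w , ·-closed a w∈W ,
      λ m → trans (cong (a *_) (u≈ m)) (distribˡ a _ (w m))

    ∼-sumFinV : ∀ {n} {f g : Fin n → Vect k} → (∀ i → f i ∼ g i) → sumFinV f ∼ sumFinV g
    ∼-sumFinV {zero}  f∼g = ≈⇒∼ (λ _ → refl)
    ∼-sumFinV {suc n} f∼g = ∼-⊕ (f∼g Fin.zero) (∼-sumFinV (λ i → f∼g (Fin.suc i)))

  module _ {k : ℕ} where

    ⟪_,_⟫ : (ℕ → Carrier) → Vect k → Carrier
    ⟪ w , x ⟫ = sum (λ i → x i * w (toℕ i))

    ⟪⟫-cong : ∀ w {x y : Vect k} → x ≈ y → ⟪ w , x ⟫ ≡ ⟪ w , y ⟫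
    ⟪⟫-cong w x≈y = sum-cong-≗ (λ i → cong (_* w (toℕ i)) (x≈y i))

    ⟪⟫-⊕ : ∀ w (x y : Vect k) → ⟪ w , x ⊕ y ⟫ ≡ ⟪ w , x ⟫ + ⟪ w , y ⟫
    ⟪⟫-⊕ w x y = trans (sum-cong-≗ (λ i → distribʳ (w (toℕ i)) (x i) (y i)))
                       (∑-distrib-+ (λ i → x i * w (toℕ i)) (λ i → y i * w (toℕ i)))

    ⟪⟫-· : ∀ w a (x : Vect k) → ⟪ w , a · x ⟫ ≡ a * ⟪ w , x ⟫
    ⟪⟫-· w a x = trans (sum-cong-≗ (λ i → *-assoc a (x i) (w (toℕ i))))
                       (sym (*-distribˡ-sum a (λ i → x i * w (toℕ i))))

    ⟪⟫-zero : ∀ w → ⟪ w , zeroV ⟫ ≡ 0#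
    ⟪⟫-zero w = sum-zero {k} _ (λ i → zeroˡ (w (toℕ i)))

    ⟪⟫-E : ∀ w {n} → n < k → ⟪ w , E n ⟫ ≡ w n
    ⟪⟫-E w {n} n<k = begin
      ⟪ w , E n ⟫          ≡⟨ sum-select _ i off-diagonal ⟩
      E n i * w (toℕ i)    ≡⟨ cong₂ _*_ (E-on i toℕi≡n) (cong w toℕi≡n) ⟩
      1# * w n             ≡⟨ *-identityˡ (w n) ⟩
      w n                  ∎
      where
      open ≡-Reasoning
      i : Fin k
      i = fromℕ< n<k
      toℕi≡n : toℕ i ≡ n
      toℕi≡n = Fin.toℕ-fromℕ< n<k
      off-diagonal : ∀ j → j ≢ i → E n j * w (toℕ j) ≡ 0#
      off-diagonal j j≢i = trans (cong (_* w (toℕ j)) (E-off j (λ eq → j≢i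
        (Fin.toℕ-injective (trans eq (sym toℕi≡n)))))) (zeroˡ (w (toℕ j)))

    ⟪⟫-sumRange : ∀ w n (f : ℕ → Vect k) → (∀ j → j < n → ⟪ w , f j ⟫ ≡ 0#) →
                  ⟪ w , sumRange n f ⟫ ≡ 0#
    ⟪⟫-sumRange w zero    f f⊥w = ⟪⟫-zero w
    ⟪⟫-sumRange w (suc n) f f⊥w = begin
      ⟪ w , sumRange n f ⊕ f n ⟫           ≡⟨ ⟪⟫-⊕ w (sumRange n f) (f n) ⟩
      ⟪ w , sumRange n f ⟫ + ⟪ w , f n ⟫   ≡⟨ cong₂ _+_ (⟪⟫-sumRange w n f f⊥w′) (f⊥w n ℕ.≤-refl) ⟩
      0# + 0#                              ≡⟨ +-identityˡ 0# ⟩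
      0#                                   ∎
      where
      open ≡-Reasoning
      f⊥w′ : ∀ j → j < n → ⟪ w , f j ⟫ ≡ 0#
      f⊥w′ j j<n = f⊥w j (ℕ.m≤n⇒m≤1+n j<n)

  coord : ∀ {k} → Vect k → ℕ → Carrier
  coord {zero}  x n       = 0#
  coord {suc k} x zero    = x Fin.zero
  coord {suc k} x (suc n) = coord (λ i → x (Fin.suc i)) n

  coord-toℕ : ∀ {k} (x : Vect k) i → coord x (toℕ i) ≡ x i
  coord-toℕ x Fin.zero    = refl
  coord-toℕ x (Fin.suc i) = coord-toℕ (λ j → x (Fin.suc j)) i

  ⟪⟫-coord : ∀ {k} w (x : Vect k) → ⟪ w , x ⟫ ≡ sumℕ k (λ n → coord x n * w n)
  ⟪⟫-coord w x = sum-cong-≗ (λ i → cong (_* w (toℕ i)) (sym (coord-toℕ x i)))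

  -- blockWeight β o t n is β ^ (o + t - 1 - n) for o ≤ n < o + t, and 0 otherwise.
  blockWeight : Carrier → ℕ → ℕ → ℕ → Carrier
  blockWeight β (suc o) t       zero    = 0#
  blockWeight β (suc o) t       (suc n) = blockWeight β o t n
  blockWeight β zero    zero    n       = 0#
  blockWeight β zero    (suc t) zero    = β ^ t
  blockWeight β zero    (suc t) (suc n) = blockWeight β zero t n

  blockWeight-step : ∀ β o t n → suc n ≢ o → suc n ≢ o ℕ.+ t →
                     blockWeight β o t n ≡ β * blockWeight β o t (suc n)
  blockWeight-step β (suc zero)    t             zero    1≢1 _    = ⊥-elim (1≢1 refl)
  blockWeight-step β (suc (suc o)) t             zero    _   _    = sym (zeroʳ β)
  blockWeight-step β (suc o)       t             (suc n) ≢o  ≢end =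
    blockWeight-step β o t n (λ eq → ≢o (cong suc eq)) (λ eq → ≢end (cong suc eq))
  blockWeight-step β zero          zero          n       _   _    = sym (zeroʳ β)
  blockWeight-step β zero          (suc zero)    zero    _   1≢1  = ⊥-elim (1≢1 refl)
  blockWeight-step β zero          (suc (suc t)) zero    _   _    = refl
  blockWeight-step β zero          (suc t)       (suc n) _   ≢end =
    blockWeight-step β zero t n (λ ()) (λ eq → ≢end (cong suc eq))

  blockWeight-last : ∀ β o t → blockWeight β o (suc t) (o ℕ.+ t) ≡ 1#
  blockWeight-last β (suc o) t       = blockWeight-last β o t
  blockWeight-last β zero    zero    = refl
  blockWeight-last β zero    (suc t) = blockWeight-last β zero t

  blockWeight-below : ∀ β {o} t {n} → n < o → blockWeight β o t n ≡ 0#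
  blockWeight-below β t {zero}  (s≤s _)   = refl
  blockWeight-below β t {suc n} (s≤s n<o) = blockWeight-below β t n<o

  blockWeight-above : ∀ β o t {n} → o ℕ.+ t ℕ.≤ n → blockWeight β o t n ≡ 0#
  blockWeight-above β (suc o) t       {suc n} (s≤s end≤n) = blockWeight-above β o t end≤n
  blockWeight-above β zero    zero    _                   = refl
  blockWeight-above β zero    (suc t) {suc n} (s≤s end≤n) = blockWeight-above β zero t end≤n

  sumℕ-blockWeight : ∀ β o t {k} (g : ℕ → Carrier) → o ℕ.+ t ℕ.≤ k →
    sumℕ k (λ n → g n * blockWeight β o t n) ≡ sumℕ t (λ j → g (o ℕ.+ (t ∸ suc j)) * β ^ j)
  sumℕ-blockWeight β (suc o) t {suc k} g (s≤s end≤k) = begin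
    g 0 * 0# + rest                                  ≡⟨ cong (_+ rest) (zeroʳ (g 0)) ⟩
    0# + rest                                        ≡⟨ +-identityˡ rest ⟩
    rest                                             ≡⟨ sumℕ-blockWeight β o t (λ n → g (suc n)) end≤k ⟩
    sumℕ t (λ j → g (suc o ℕ.+ (t ∸ suc j)) * β ^ j) ∎
    where
    open ≡-Reasoning
    rest : Carrier
    rest = sumℕ k (λ n → g (suc n) * blockWeight β o t n)
  sumℕ-blockWeight β zero zero {k} g _ = sum-zero {k} _ (λ i → zeroʳ (g (toℕ i)))
  sumℕ-blockWeight β zero (suc t) {suc k} g (s≤s t≤k) = begin
    g 0 * β ^ t + sumℕ k (λ n → g (suc n) * blockWeight β zero t n)
      ≡⟨ cong (g 0 * β ^ t +_) (sumℕ-blockWeight β zero t (λ n → g (suc n)) t≤k) ⟩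
    g 0 * β ^ t + sumℕ t (λ j → g (suc (t ∸ suc j)) * β ^ j)
      ≡⟨ +-comm _ _ ⟩
    sumℕ t (λ j → g (suc (t ∸ suc j)) * β ^ j) + g 0 * β ^ t
      ≡⟨ cong₂ _+_ (sumℕ-cong t (λ j j<t → cong (λ m → g m * β ^ j) (sym (ℕ.+-∸-assoc 1 j<t))))
                   (cong (λ m → g m * β ^ t) (sym (ℕ.n∸n≡0 t))) ⟩
    sumℕ t (λ j → g (t ∸ j) * β ^ j) + g (t ∸ t) * β ^ t
      ≡⟨ sym (sumℕ-snoc t (λ j → g (suc t ∸ suc j) * β ^ j)) ⟩
    sumℕ (suc t) (λ j → g (suc t ∸ suc j) * β ^ j)
      ∎
    where open ≡-Reasoning

  0#∈Fq : .{{ℕ.NonZero q}} → InFq F q 0#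
  0#∈Fq = zero-^ q
    where
    zero-^ : ∀ n → .{{ℕ.NonZero n}} → 0# ^ n ≡ 0#
    zero-^ (suc n) = zeroˡ (0# ^ n)

  coord∈Fq : .{{ℕ.NonZero q}} → ∀ {k} {x : Vect k} → (∀ i → InFq F q (x i)) → ∀ n → InFq F q (coord x n)
  coord∈Fq {zero}  x∈Fq n       = 0#∈Fq
  coord∈Fq {suc k} x∈Fq zero    = x∈Fq Fin.zero
  coord∈Fq {suc k} x∈Fq (suc n) = coord∈Fq (λ i → x∈Fq (Fin.suc i)) n

  restrict : ℕ → (ℕ → Carrier) → ℕ → Carrier
  restrict t g m with m <? t
  ... | yes _ = g m
  ... | no  _ = 0#

  restrict-< : ∀ {t} g {m} → m < t → restrict t g m ≡ g m
  restrict-< {t} g {m} m<t with m <? t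
  ... | yes _   = refl
  ... | no  m≮t = ⊥-elim (m≮t m<t)

  restrict-≥ : ∀ {t} g {m} → t ℕ.≤ m → restrict t g m ≡ 0#
  restrict-≥ {t} g {m} t≤m with m <? t
  ... | yes m<t = ⊥-elim (ℕ.<⇒≱ m<t t≤m)
  ... | no  _   = refl

  restrict∈Fq : .{{ℕ.NonZero q}} → ∀ t {g} → (∀ j → InFq F q (g j)) → ∀ m → InFq F q (restrict t g m)
  restrict∈Fq t g∈Fq m with m <? t
  ... | yes _ = g∈Fq m
  ... | no  _ = 0#∈Fq

  sumℕ-restrict : ∀ {t s} → t ℕ.≤ s → (g f : ℕ → Carrier) →
                  sumℕ s (λ m → restrict t g m * f m) ≡ sumℕ t (λ m → g m * f m)
  sumℕ-restrict {t} t≤s g f = trans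
    (sumℕ-truncate t≤s _ (λ m t≤m → trans (cong (_* f m) (restrict-≥ g t≤m)) (zeroˡ (f m))))
    (sumℕ-cong t (λ m m<t → cong (_* f m) (restrict-< g m<t)))

  powers-independent : .{{ℕ.NonZero q}} → ∀ {β s} → DegreeOver F q β s → ∀ {t} → t ℕ.≤ s →
    (g : ℕ → Carrier) → (∀ j → InFq F q (g j)) →
    sumℕ t (λ j → g j * β ^ j) ≡ 0# → ∀ {j} → j < t → g j ≡ 0#
  powers-independent {β} {s} (independent , _) {t} t≤s g g∈Fq Σ≡0 {j} j<t = begin
    g j                             ≡⟨ sym (restrict-< g j<t) ⟩
    restrict t g j                  ≡⟨ cong (restrict t g) (sym (Fin.toℕ-fromℕ< j<s)) ⟩
    restrict t g (toℕ (fromℕ< j<s)) ≡⟨ independent (λ i → restrict t g (toℕ i))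
                                         (λ i → restrict∈Fq t g∈Fq (toℕ i)) restricted-sum≡0 (fromℕ< j<s) ⟩
    0#                              ∎
    where
    open ≡-Reasoning
    j<s : j < s
    j<s = ℕ.<-≤-trans j<t t≤s
    restricted-sum≡0 : Defs.sumFin F q {s} (λ i → restrict t g (toℕ i) * β ^ toℕ i) ≡ 0#
    restricted-sum≡0 = trans (sumFin≡sum {s} _) (trans (sumℕ-restrict t≤s g (β ^_)) Σ≡0)

  block-vanishes : .{{ℕ.NonZero q}} → ∀ {β s k} → DegreeOver F q β s →
    ∀ o t → suc t ℕ.≤ s → o ℕ.+ suc t ℕ.≤ k →
    (c : Vect k) → (∀ i → InFq F q (c i)) → ⟪ blockWeight β o (suc t) , c ⟫ ≡ 0# →
    ∀ i → o ℕ.≤ toℕ i → toℕ i ℕ.≤ o ℕ.+ t → c i ≡ 0#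
  block-vanishes {β} degree o t t<s block≤k c c∈Fq ⟪c⟫≡0 i o≤i i≤end = begin
    c i                              ≡⟨ sym (coord-toℕ c i) ⟩
    coord c (toℕ i)                  ≡⟨ cong (coord c) (sym o+[t∸[t∸d]]≡i) ⟩
    coord c (o ℕ.+ (t ∸ (t ∸ d)))    ≡⟨ coefficient≡0 (s≤s (ℕ.m∸n≤m t d)) ⟩
    0#                               ∎
    where
    open ≡-Reasoning
    d : ℕ
    d = toℕ i ∸ o
    o+d≡i : o ℕ.+ d ≡ toℕ i
    o+d≡i = ℕ.m+[n∸m]≡n o≤i
    d≤t : d ℕ.≤ t
    d≤t = ℕ.+-cancelˡ-≤ o d t (subst (ℕ._≤ o ℕ.+ t) (sym o+d≡i) i≤end)
    o+[t∸[t∸d]]≡i : o ℕ.+ (t ∸ (t ∸ d)) ≡ toℕ i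
    o+[t∸[t∸d]]≡i = trans (cong (o ℕ.+_) (ℕ.m∸[m∸n]≡n d≤t)) o+d≡i
    coefficient≡0 : ∀ {j} → j < suc t → coord c (o ℕ.+ (suc t ∸ suc j)) ≡ 0#
    coefficient≡0 = powers-independent degree t<s (λ j → coord c (o ℕ.+ (suc t ∸ suc j)))
      (λ j → coord∈Fq c∈Fq _)
      (trans (sym (sumℕ-blockWeight β o (suc t) (coord c) block≤k))
             (trans (sym (⟪⟫-coord (blockWeight β o (suc t)) c)) ⟪c⟫≡0))

module Projection (F : Field) (q : ℕ) (α : Field.Carrier F) (d₁ d₂ : ℕ) where
  open Field F
  open LinearAlgebra F q
  open Config F q α (suc d₁) (suc d₂)

  top : ℕ
  top = d₁ ℕ.+ suc d₂

  d₁<k : d₁ < k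
  d₁<k = s≤s (ℕ.m≤m+n d₁ (suc d₂))

  top<k : top < k
  top<k = ℕ.≤-refl

  e : ℕ → Vect k
  e = E

  weight₁ weight₂ : ℕ → Carrier
  weight₁ = blockWeight α 0 (suc d₁)
  weight₂ = blockWeight α (suc d₁) (suc d₂)

  A B : Vect k → Carrier
  A x = ⟪ weight₁ , x ⟫
  B x = ⟪ weight₂ , x ⟫

  project : Vect k → Vect k
  project x = A x · eΩ₁ ⊕ B x · eΩ₂

  gen : ℕ → Vect k
  gen n = e n ⊕ (- α) · e (suc n)

  GeneratorIndex : ℕ → Set
  GeneratorIndex n = n ≢ d₁ × suc n < k

  gen₁-index : ∀ {j} → j < d₁ → GeneratorIndex j
  gen₁-index j<d₁ = (λ j≡d₁ → ℕ.<-irrefl j≡d₁ j<d₁) , s≤s (ℕ.≤-trans j<d₁ (ℕ.m≤m+n d₁ (suc d₂)))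

  gen₂-index : ∀ {j} → j < d₂ → GeneratorIndex (suc d₁ ℕ.+ j)
  gen₂-index {j} j<d₂ = (λ eq → ℕ.<-irrefl (sym eq) (s≤s (ℕ.m≤m+n d₁ j))) ,
    subst (λ m → suc (suc d₁ ℕ.+ j) < suc m) (sym (ℕ.+-suc d₁ d₂)) (ℕ.+-monoʳ-< (suc (suc d₁)) j<d₂)

  gen₂-index⁻¹ : ∀ {n} → d₁ < n → suc n < k → Σ ℕ λ j → j < d₂ × suc d₁ ℕ.+ j ≡ n
  gen₂-index⁻¹ {n} d₁<n sn<k = j , j<d₂ , d₁+j≡n
    where
    j : ℕ
    j = n ∸ suc d₁
    d₁+j≡n : suc d₁ ℕ.+ j ≡ n
    d₁+j≡n = ℕ.m+[n∸m]≡n d₁<n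
    j<d₂ : j < d₂
    j<d₂ = ℕ.s<s⁻¹ (ℕ.+-cancelˡ-< (suc d₁) (suc j) (suc d₂)
      (subst (_< k) (sym (trans (ℕ.+-suc (suc d₁) j) (cong suc d₁+j≡n))) sn<k))

  gen₂≡gen : ∀ j → gen₂ j ≡ gen (suc d₁ ℕ.+ j)
  gen₂≡gen j = cong (λ m → e (suc d₁ ℕ.+ j) ⊕ (- α) · e m) (ℕ.+-suc (suc d₁) j)

  Π-subspace : IsSubspace InΠ
  Π-subspace = record
    { zeroV∈   = (λ _ → 0#) , (λ _ → 0#) , λ m →
        sym (trans (cong₂ _+_ (combination-0 d₁ gen₁ m) (combination-0 d₂ gen₂ m)) (+-identityˡ 0#))
    ; ⊕-closed = λ { (c₁ , c₂ , u≈) (c₁′ , c₂′ , v≈) →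
        (λ j → c₁ j + c₁′ j) , (λ j → c₂ j + c₂′ j) , λ m →
        trans (cong₂ _+_ (u≈ m) (v≈ m)) (trans (+-interchange _ _ _ _)
          (sym (cong₂ _+_ (combination-+ d₁ gen₁ c₁ c₁′ m) (combination-+ d₂ gen₂ c₂ c₂′ m)))) }
    ; ·-closed = λ { a (c₁ , c₂ , v≈) → (λ j → a * c₁ j) , (λ j → a * c₂ j) , λ m →
        trans (cong (a *_) (v≈ m)) (trans (distribˡ a _ _)
          (sym (cong₂ _+_ (combination-* d₁ gen₁ a c₁ m) (combination-* d₂ gen₂ a c₂ m)))) }
    ; ≈-closed = λ { u≈v (c₁ , c₂ , u≈) → c₁ , c₂ , λ m → trans (sym (u≈v m)) (u≈ m) }
    }

  open Congruence Π-subspace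

  gen∈Π : ∀ {n} → GeneratorIndex n → InΠ (gen n)
  gen∈Π {n} (n≢d₁ , sn<k) with n <? d₁
  ... | yes n<d₁ = unit n , (λ _ → 0#) , λ m →
          sym (trans (cong₂ _+_ (combination-unit d₁ gen₁ n<d₁ m) (combination-0 d₂ gen₂ m)) (+-identityʳ _))
  ... | no  n≮d₁ with gen₂-index⁻¹ (ℕ.≤∧≢⇒< (ℕ.≮⇒≥ n≮d₁) (λ eq → n≢d₁ (sym eq))) sn<k
  ...   | j , j<d₂ , refl = (λ _ → 0#) , unit j , λ m → sym (trans
          (cong₂ _+_ (combination-0 d₁ gen₁ m) (combination-unit d₂ gen₂ j<d₂ m))
          (trans (+-identityˡ _) (cong (λ v → v m) (gen₂≡gen j))))

  e∼αe : ∀ {n} → GeneratorIndex n → e n ∼ α · e (suc n)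
  e∼αe {n} idx = gen n , gen∈Π idx , λ m → sym (begin
    α * e (suc n) m + (e n m + - α * e (suc n) m)   ≡⟨ +-left-comm _ _ _ ⟩
    e n m + (α * e (suc n) m + - α * e (suc n) m)   ≡⟨ cong (e n m +_) (sym (distribʳ _ α (- α))) ⟩
    e n m + (α + - α) * e (suc n) m                 ≡⟨ cong (λ a → e n m + a * e (suc n) m) (-‿inverseʳ α) ⟩
    e n m + 0# * e (suc n) m                        ≡⟨ cong (e n m +_) (zeroˡ _) ⟩
    e n m + 0#                                      ≡⟨ +-identityʳ _ ⟩
    e n m                                           ∎)
    where open ≡-Reasoning

  RecursAlongGenerators : (ℕ → Carrier) → Set
  RecursAlongGenerators w = ∀ {n} → GeneratorIndex n → w n ≡ α * w (suc n)

  weight₁-recurs : RecursAlongGenerators weight₁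
  weight₁-recurs {n} (n≢d₁ , _) =
    blockWeight-step α 0 (suc d₁) n (λ ()) (λ eq → n≢d₁ (ℕ.suc-injective eq))

  weight₂-recurs : RecursAlongGenerators weight₂
  weight₂-recurs {n} (n≢d₁ , sn<k) =
    blockWeight-step α (suc d₁) (suc d₂) n (λ eq → n≢d₁ (ℕ.suc-injective eq)) (λ eq → ℕ.<-irrefl eq sn<k)

  ⟪⟫-e-recurs : ∀ {w} → RecursAlongGenerators w → ∀ {n} → GeneratorIndex n →
                ⟪ w , e n ⟫ ≡ α * ⟪ w , e (suc n) ⟫
  ⟪⟫-e-recurs {w} recurs {n} idx@(_ , sn<k) = begin
    ⟪ w , e n ⟫             ≡⟨ ⟪⟫-E w (ℕ.<-trans (ℕ.n<1+n n) sn<k) ⟩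
    w n                     ≡⟨ recurs idx ⟩
    α * w (suc n)           ≡⟨ cong (α *_) (sym (⟪⟫-E w sn<k)) ⟩
    α * ⟪ w , e (suc n) ⟫   ∎
    where open ≡-Reasoning

  ⟪⟫-gen : ∀ {w} → RecursAlongGenerators w → ∀ {n} → GeneratorIndex n → ⟪ w , gen n ⟫ ≡ 0#
  ⟪⟫-gen {w} recurs {n} idx = begin
    ⟪ w , e n ⊕ (- α) · e (suc n) ⟫         ≡⟨ ⟪⟫-⊕ w (e n) ((- α) · e (suc n)) ⟩
    ⟪ w , e n ⟫ + ⟪ w , (- α) · e (suc n) ⟫ ≡⟨ cong₂ _+_ (⟪⟫-e-recurs recurs idx) (⟪⟫-· w (- α) (e (suc n))) ⟩
    α * y + - α * y                         ≡⟨ sym (distribʳ y α (- α)) ⟩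
    (α + - α) * y                           ≡⟨ cong (_* y) (-‿inverseʳ α) ⟩
    0# * y                                  ≡⟨ zeroˡ y ⟩
    0#                                      ∎
    where
    open ≡-Reasoning
    y : Carrier
    y = ⟪ w , e (suc n) ⟫

  ⟪⟫-Π : ∀ {w} → RecursAlongGenerators w → ∀ {v} → InΠ v → ⟪ w , v ⟫ ≡ 0#
  ⟪⟫-Π {w} recurs {v} (c₁ , c₂ , v≈) = begin
    ⟪ w , v ⟫                        ≡⟨ ⟪⟫-cong w v≈ ⟩
    ⟪ w , comb₁ ⊕ comb₂ ⟫            ≡⟨ ⟪⟫-⊕ w comb₁ comb₂ ⟩
    ⟪ w , comb₁ ⟫ + ⟪ w , comb₂ ⟫    ≡⟨ cong₂ _+_
      (⟪⟫-sumRange w d₁ (λ j → c₁ j · gen₁ j) (λ j j<d₁ → scaled (c₁ j) (gen₁-index j<d₁)))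
      (⟪⟫-sumRange w d₂ (λ j → c₂ j · gen₂ j) (λ j j<d₂ →
        trans (cong (λ v → ⟪ w , c₂ j · v ⟫) (gen₂≡gen j)) (scaled (c₂ j) (gen₂-index j<d₂)))) ⟩
    0# + 0#                          ≡⟨ +-identityˡ 0# ⟩
    0#                               ∎
    where
    open ≡-Reasoning
    comb₁ comb₂ : Vect k
    comb₁ = combination d₁ gen₁ c₁
    comb₂ = combination d₂ gen₂ c₂
    scaled : ∀ c {n} → GeneratorIndex n → ⟪ w , c · gen n ⟫ ≡ 0#
    scaled c idx = trans (⟪⟫-· w c (gen _)) (trans (cong (c *_) (⟪⟫-gen recurs idx)) (zeroʳ c))

  ⟪⟫-∼ : ∀ {w} → RecursAlongGenerators w → ∀ {u v} → u ∼ v → ⟪ w , u ⟫ ≡ ⟪ w , v ⟫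
  ⟪⟫-∼ {w} recurs {u} {v} (x , x∈Π , u≈v⊕x) = begin
    ⟪ w , u ⟫                ≡⟨ ⟪⟫-cong w u≈v⊕x ⟩
    ⟪ w , v ⊕ x ⟫            ≡⟨ ⟪⟫-⊕ w v x ⟩
    ⟪ w , v ⟫ + ⟪ w , x ⟫    ≡⟨ cong (⟪ w , v ⟫ +_) (⟪⟫-Π recurs x∈Π) ⟩
    ⟪ w , v ⟫ + 0#           ≡⟨ +-identityʳ _ ⟩
    ⟪ w , v ⟫                ∎
    where open ≡-Reasoning

  A-eΩ₁ : A eΩ₁ ≡ 1#
  A-eΩ₁ = trans (⟪⟫-E weight₁ d₁<k) (blockWeight-last α 0 d₁)

  B-eΩ₁ : B eΩ₁ ≡ 0#
  B-eΩ₁ = trans (⟪⟫-E weight₂ d₁<k) (blockWeight-below α (suc d₂) (ℕ.n<1+n d₁))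

  A-eΩ₂ : A eΩ₂ ≡ 0#
  A-eΩ₂ = trans (⟪⟫-E weight₁ top<k) (blockWeight-above α 0 (suc d₁)
    (subst (suc d₁ ℕ.≤_) (sym (ℕ.+-suc d₁ d₂)) (s≤s (ℕ.m≤m+n d₁ d₂))))

  B-eΩ₂ : B eΩ₂ ≡ 1#
  B-eΩ₂ = trans (⟪⟫-E weight₂ top<k)
    (trans (cong weight₂ (ℕ.+-suc d₁ d₂)) (blockWeight-last α (suc d₁) d₂))

  ⟪⟫-Ω : ∀ w a b → ⟪ w , a · eΩ₁ ⊕ b · eΩ₂ ⟫ ≡ a * ⟪ w , eΩ₁ ⟫ + b * ⟪ w , eΩ₂ ⟫
  ⟪⟫-Ω w a b = trans (⟪⟫-⊕ w (a · eΩ₁) (b · eΩ₂)) (cong₂ _+_ (⟪⟫-· w a eΩ₁) (⟪⟫-· w b eΩ₂))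

  A-Ω : ∀ a b → A (a · eΩ₁ ⊕ b · eΩ₂) ≡ a
  A-Ω a b = begin
    A (a · eΩ₁ ⊕ b · eΩ₂)     ≡⟨ ⟪⟫-Ω weight₁ a b ⟩
    a * A eΩ₁ + b * A eΩ₂     ≡⟨ cong₂ (λ x y → a * x + b * y) A-eΩ₁ A-eΩ₂ ⟩
    a * 1# + b * 0#           ≡⟨ cong₂ _+_ (*-identityʳ a) (zeroʳ b) ⟩
    a + 0#                    ≡⟨ +-identityʳ a ⟩
    a                         ∎
    where open ≡-Reasoning

  B-Ω : ∀ a b → B (a · eΩ₁ ⊕ b · eΩ₂) ≡ b
  B-Ω a b = begin
    B (a · eΩ₁ ⊕ b · eΩ₂)     ≡⟨ ⟪⟫-Ω weight₂ a b ⟩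
    a * B eΩ₁ + b * B eΩ₂     ≡⟨ cong₂ (λ x y → a * x + b * y) B-eΩ₁ B-eΩ₂ ⟩
    a * 0# + b * 1#           ≡⟨ cong₂ _+_ (zeroʳ a) (*-identityʳ b) ⟩
    0# + b                    ≡⟨ +-identityˡ b ⟩
    b                         ∎
    where open ≡-Reasoning

  project∈Ω : ∀ x → InΩ (project x)
  project∈Ω x = A x , B x , λ _ → refl

  project-Ω : ∀ {P} → InΩ P → project P ≈ P
  project-Ω (a , b , P≈) m = trans
    (cong₂ (λ x y → x * eΩ₁ m + y * eΩ₂ m) (trans (⟪⟫-cong weight₁ P≈) (A-Ω a b))
                                           (trans (⟪⟫-cong weight₂ P≈) (B-Ω a b)))
    (sym (P≈ m))

  project-∼ : ∀ {u v} → u ∼ v → project u ≈ project v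
  project-∼ u∼v m =
    cong₂ (λ x y → x * eΩ₁ m + y * eΩ₂ m) (⟪⟫-∼ weight₁-recurs u∼v) (⟪⟫-∼ weight₂-recurs u∼v)

  project-· : ∀ a x → project (a · x) ≈ a · project x
  project-· a x m = trans
    (cong₂ (λ x y → x * eΩ₁ m + y * eΩ₂ m) (⟪⟫-· weight₁ a x) (⟪⟫-· weight₂ a x))
    (sym (*-distribˡ-combination a (A x) (B x) (eΩ₁ m) (eΩ₂ m)))

  project-e-recurs : ∀ {n} → GeneratorIndex n → project (e n) ≈ α · project (e (suc n))
  project-e-recurs {n} idx m = trans
    (cong₂ (λ a b → a * eΩ₁ m + b * eΩ₂ m)
           (⟪⟫-e-recurs weight₁-recurs idx) (⟪⟫-e-recurs weight₂-recurs idx))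
    (sym (*-distribˡ-combination α (A (e (suc n))) (B (e (suc n))) (eΩ₁ m) (eΩ₂ m)))

  project≈0⇒A≡0 : ∀ {x} → project x ≈ zeroV → A x ≡ 0#
  project≈0⇒A≡0 {x} px≈0 =
    trans (sym (A-Ω (A x) (B x))) (trans (⟪⟫-cong weight₁ px≈0) (⟪⟫-zero {k} weight₁))

  project≈0⇒B≡0 : ∀ {x} → project x ≈ zeroV → B x ≡ 0#
  project≈0⇒B≡0 {x} px≈0 =
    trans (sym (B-Ω (A x) (B x))) (trans (⟪⟫-cong weight₂ px≈0) (⟪⟫-zero {k} weight₂))

  eΩ₁∈Ω : InΩ eΩ₁
  eΩ₁∈Ω = 1# , 0# , λ m →
    sym (trans (cong₂ _+_ (*-identityˡ (eΩ₁ m)) (zeroˡ (eΩ₂ m))) (+-identityʳ (eΩ₁ m)))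

  eΩ₂∈Ω : InΩ eΩ₂
  eΩ₂∈Ω = 0# , 1# , λ m →
    sym (trans (cong₂ _+_ (zeroˡ (eΩ₁ m)) (*-identityˡ (eΩ₂ m))) (+-identityˡ (eΩ₂ m)))

  Ω∼project : ∀ {P} → InΩ P → P ∼ project P
  Ω∼project P∈Ω = ≈⇒∼ (λ m → sym (project-Ω P∈Ω m))

  -- Downward induction on n, where m = top − n: e d₁ and e top lie on Ω, and every other
  -- e n is α · e (n + 1) modulo Π.
  e∼project-from : ∀ m {n} → n ℕ.+ m ≡ top → e n ∼ project (e n)
  e∼project-from m {n} n+m≡top with n ℕ.≟ d₁
  e∼project-from m       {n} n+m≡top | yes refl = Ω∼project eΩ₁∈Ω
  e∼project-from zero    {n} n+0≡top | no  _    =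
    subst (λ n → e n ∼ project (e n)) (sym (trans (sym (ℕ.+-identityʳ n)) n+0≡top)) (Ω∼project eΩ₂∈Ω)
  e∼project-from (suc m) {n} n+m≡top | no  n≢d₁ =
    ∼-≈-trans (∼-trans (e∼αe idx) (∼-· α (e∼project-from m sn+m≡top)))
              (λ i → sym (project-e-recurs idx i))
    where
    sn+m≡top : suc n ℕ.+ m ≡ top
    sn+m≡top = trans (sym (ℕ.+-suc n m)) n+m≡top
    idx : GeneratorIndex n
    idx = n≢d₁ , s≤s (subst (suc n ℕ.≤_) sn+m≡top (ℕ.m≤m+n (suc n) m))

  e∼project : ∀ {n} → n < k → e n ∼ project (e n)
  e∼project {n} n<k = e∼project-from (top ∸ n) (ℕ.m+[n∸m]≡n (ℕ.≤-pred n<k))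

  basis : Fin k → Vect k
  basis i = project (e (toℕ i))

  sumFinV-basis : ∀ c → sumFinV (λ i → c i · basis i) ≈ project c
  sumFinV-basis c m = begin
    sumFinV (λ i → c i · basis i) m
      ≡⟨ sumFinV-coord (λ i → c i · basis i) m ⟩
    sum (λ i → c i * (a i * eΩ₁ m + b i * eΩ₂ m))
      ≡⟨ sum-cong-≗ (λ i → *-distribˡ-combination (c i) (a i) (b i) (eΩ₁ m) (eΩ₂ m)) ⟩
    sum (λ i → c i * a i * eΩ₁ m + c i * b i * eΩ₂ m)
      ≡⟨ ∑-distrib-+ (λ i → c i * a i * eΩ₁ m) (λ i → c i * b i * eΩ₂ m) ⟩
    sum (λ i → c i * a i * eΩ₁ m) + sum (λ i → c i * b i * eΩ₂ m)
      ≡⟨ sym (cong₂ _+_ (*-distribʳ-sum (eΩ₁ m) (λ i → c i * a i))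
                        (*-distribʳ-sum (eΩ₂ m) (λ i → c i * b i))) ⟩
    sum (λ i → c i * a i) * eΩ₁ m + sum (λ i → c i * b i) * eΩ₂ m
      ≡⟨ cong₂ (λ x y → x * eΩ₁ m + y * eΩ₂ m)
               (sum-cong-≗ (λ i → cong (c i *_) (⟪⟫-E weight₁ (Fin.toℕ<n i))))
               (sum-cong-≗ (λ i → cong (c i *_) (⟪⟫-E weight₂ (Fin.toℕ<n i)))) ⟩
    A c * eΩ₁ m + B c * eΩ₂ m
      ∎
    where
    open ≡-Reasoning
    a b : Fin k → Carrier
    a i = A (e (toℕ i))
    b i = B (e (toℕ i))

  ∼-project : ∀ x → x ∼ project x
  ∼-project x = ≈-∼-trans (basis-expansion x)
    (∼-≈-trans (∼-sumFinV (λ i → ∼-· (x i) (e∼project (Fin.toℕ<n i)))) (sumFinV-basis x))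

  project-kernel-Fq : .{{ℕ.NonZero q}} → ∀ {s} → DegreeOver F q α s → top ℕ.≤ s →
    ∀ c → (∀ i → InFq F q (c i)) → project c ≈ zeroV → ∀ i → c i ≡ 0#
  project-kernel-Fq degree top≤s c c∈Fq pc≈0 i with toℕ i ℕ.≤? d₁
  ... | yes i≤d₁ = block-vanishes degree 0 d₁ (ℕ.≤-trans (ℕ.m<m+n d₁ (s≤s z≤n)) top≤s) d₁<k
                     c c∈Fq (project≈0⇒A≡0 {c} pc≈0) i z≤n i≤d₁
  ... | no  i≰d₁ = block-vanishes degree (suc d₁) d₂ (ℕ.≤-trans (ℕ.m≤n+m (suc d₂) d₁) top≤s) ℕ.≤-refl
                     c c∈Fq (project≈0⇒B≡0 {c} pc≈0) i (ℕ.≰⇒> i≰d₁)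
                     (subst (toℕ i ℕ.≤_) (ℕ.+-suc d₁ d₂) (ℕ.≤-pred (Fin.toℕ<n i)))

  basis-independent : .{{ℕ.NonZero q}} → ∀ {s} → DegreeOver F q α s → top ℕ.≤ s →
                      FqIndependent F q basis
  basis-independent degree top≤s c c∈Fq Σ≈0 =
    project-kernel-Fq degree top≤s c c∈Fq (λ m → trans (sym (sumFinV-basis c m)) (Σ≈0 m))

  projection⇒span : ∀ {P} → InProjection P →
                    Σ (Vect k) λ v → InFqSpan F q basis v × SamePoint F q P v
  projection⇒span {P} (P≢0 , P∈Ω , x , (_ , x∈Fq) , c , P∼cx) =
    v , (x , x∈Fq , λ _ → refl) , P≢0 , v≢0 , c , c≢0 , P≈cv
    where
    open ≡-Reasoning
    v : Vect k
    v = sumFinV (λ i → x i · basis i)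
    P≈cv : P ≈ c · v
    P≈cv m = begin
      P m                ≡⟨ sym (project-Ω P∈Ω m) ⟩
      project P m        ≡⟨ project-∼ P∼cx m ⟩
      project (c · x) m  ≡⟨ project-· c x m ⟩
      c * project x m    ≡⟨ cong (c *_) (sym (sumFinV-basis x m)) ⟩
      c * v m            ∎
    v≢0 : NonZero F q v
    v≢0 v≈0 = P≢0 (λ m → trans (P≈cv m) (trans (cong (c *_) (v≈0 m)) (zeroʳ c)))
    c≢0 : c ≢ 0#
    c≢0 c≡0 = P≢0 (λ m → trans (P≈cv m) (trans (cong (_* v m) c≡0) (zeroˡ (v m))))

  span⇒projection : ∀ {P} → (Σ (Vect k) λ v → InFqSpan F q basis v × SamePoint F q P v) →
                    InProjection P
  span⇒projection {P} (v , (c , c∈Fq , v≈) , P≢0 , v≢0 , a , _ , P≈av) =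
    P≢0 , P∈Ω , c , (c≢0 , c∈Fq) , a , ≈-∼-trans P≈a·pc (∼-· a (∼-sym (∼-project c)))
    where
    v≈pc : v ≈ project c
    v≈pc m = trans (v≈ m) (sumFinV-basis c m)
    P≈a·pc : P ≈ a · project c
    P≈a·pc m = trans (P≈av m) (cong (a *_) (v≈pc m))
    P∈Ω : InΩ P
    P∈Ω = a * A c , a * B c , λ m →
      trans (P≈a·pc m) (*-distribˡ-combination a (A c) (B c) (eΩ₁ m) (eΩ₂ m))
    c≢0 : NonZero F q c
    c≢0 c≈0 = v≢0 (λ m → trans (v≈pc m) (trans (project-∼ (≈⇒∼ c≈0) m) (project-Ω zero∈Ω m)))
      where
      zero∈Ω : InΩ zeroV
      zero∈Ω = 0# , 0# , λ m →
        sym (trans (cong₂ _+_ (zeroˡ (eΩ₁ m)) (zeroˡ (eΩ₂ m))) (+-identityˡ 0#))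

open import Data.Nat using (ℕ; _∸_; _≤_; _+_; _^_)
open import Data.Nat.Divisibility using (_∣_)
open import Relation.Nullary using (¬_)

lemma2p2 : (q h : ℕ) → IsPrimePower q → 2 ≤ h →
    (F : Field) → HasOrder F (q ^ h) →
    (t₁ t₂ : ℕ) → 1 ≤ t₁ → 1 ≤ t₂ →
    (α : Field.Carrier F) → ¬ InFq F q α →
    (s : ℕ) → DegreeOver F q α s → (t₁ + t₂) ∸ 1 ≤ s → s ∣ h →
    IsLinearSetOfRankIn F q (t₁ + t₂)
      (Config.InΩ F q α t₁ t₂) (Config.InProjection F q α t₁ t₂)
lemma2p2 q h (p , n , p-prime , _ , q≡pⁿ) _ F _ (suc d₁) (suc d₂) _ _ α _ s degree top≤s _ =
  basis , (λ i → project∈Ω (e (toℕ i))) , basis-independent degree top≤s ,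
  λ P → mk⇔ projection⇒span span⇒projection
  where
  open Projection F q α d₁ d₂
  instance
    q≢0 : ℕ.NonZero q
    q≢0 = subst ℕ.NonZero (sym q≡pⁿ) (ℕ.m^n≢0 p n {{prime⇒nonZero p-prime}})
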